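{- Let $m\ge 1$. For each integer $k$ with $m^2\le k\le m^2+(m-1)^2$, there exists a matrix in $\Lambda_{2m}^m$ having a critical set of size $k$.
   Context: $\Lambda_{n}^{x}$ is the set of $n\times n$ $(0,1)$-matrices with every row sum and every column sum equal to $x$. A matrix $M$ is identified with the set of triples $\{(i,j,M_{ij})\}$. A subset $D\subseteq M$ is a defining set for $M$ if $M$ is the unique element of $\Lambda_{2m}^m$ containing $D$; a critical set is a defining set none of whose proper subsets is a defining set; its size is its number of triples. -}

module Defs where

open import Data.Nat using (ℕ; zero; suc; _+_)
open import Data.Bool using (Bool; true; false; T)
open import Data.Fin using (Fin; zero; suc)
open import Data.Product using (_×_)
open import Relation.Binary.PropositionalEquality using (_≡_)
open import Relation.Nullary using (¬_)

-- An n×n (0,1)-matrix: entry true = 1, false = 0.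
Matrix : ℕ → Set
Matrix n = Fin n → Fin n → Bool

val : Bool → ℕ
val true  = 1
val false = 0

sumFin : {n : ℕ} → (Fin n → ℕ) → ℕ
sumFin {zero}  f = 0
sumFin {suc n} f = f zero + sumFin (λ j → f (suc j))

InLambda : (n x : ℕ) → Matrix n → Set
InLambda n x M =
  (∀ i → sumFin (λ j → val (M i j)) ≡ x) × (∀ j → sumFin (λ i → val (M i j)) ≡ x)

-- A subset D of the triple set {(i,j,M i j)} of M is determined by the set of
-- cells (i,j) it contains; we represent it by its cell indicator S.
Cells : ℕ → Set
Cells n = Fin n → Fin n → Bool

size : {n : ℕ} → Cells n → ℕ
size S = sumFin (λ i → sumFin (λ j → val (S i j)))

_⊆C_ : {n : ℕ} → Cells n → Cells n → Set
S ⊆C S' = ∀ i j → T (S i j) → T (S' i j)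

_⊂C_ : {n : ℕ} → Cells n → Cells n → Set
S ⊂C S' = S ⊆C S' × ¬ (∀ i j → S i j ≡ S' i j)

-- D (cells S of M) is a defining set for M in Λ_n^x: M is the unique element of
-- Λ_n^x containing D.  (M itself contains D, so this is: M ∈ Λ_n^x and every
-- M' ∈ Λ_n^x agreeing with M on S equals M.)
IsDefining : (n x : ℕ) → Matrix n → Cells n → Set
IsDefining n x M S =
  InLambda n x M ×
  (∀ (M' : Matrix n) → InLambda n x M' →
     (∀ i j → T (S i j) → M' i j ≡ M i j) → ∀ i j → M' i j ≡ M i j)

IsCritical : (n x : ℕ) → Matrix n → Cells n → Set
IsCritical n x M S =
  IsDefining n x M S × (∀ S' → S' ⊂C S → ¬ IsDefining n x M S')

module Submission where

-- Defining sets come from a potential argument.  Give every row i a potential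
-- hr i and every column j a potential hc j, and call a cell forced when
-- hr i < hc j for a 1-entry and hc j < hr i for a 0-entry.  The total
-- Σ val(N i j) · (hc j − hr i) is the same for all N ∈ Λ_n^x, while altering
-- forced cells of M strictly lowers it; hence the non-forced ("slack") cells
-- of M form a defining set.  Such a set is critical as soon as each of its
-- cells is a corner of an alternating rectangle [b ¬b; ¬b b] whose three
-- other corners are not in the set: flipping the rectangle gives a second
-- matrix of Λ_n^x agreeing with M on the set minus that corner.

open import Defs
open import Data.Nat using (ℕ; zero; suc; _≤_; _<_; _*_; _+_; _∸_; z≤n; s≤s; _<ᵇ_)
open import Data.Nat.Properties
open import Data.Nat.Tactic.RingSolver using (solve-∀)
open import Data.Nat.DivMod using (_/_; _%_; m%n<n; m≡m%n+[m/n]*n; /-monoˡ-≤; m*n/n≡m)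
open import Data.Bool using (Bool; true; false; T; not; _∧_; if_then_else_)
open import Data.Bool.Properties using (not-involutive; not-¬; ∧-zeroʳ; T-≡) renaming (_≟_ to _≟ᵇ_)
open import Data.Unit using (tt)
open import Data.Fin using (Fin; zero; suc; toℕ; fromℕ<)
open import Data.Fin.Properties using (toℕ<n; toℕ-fromℕ<; ¬∀⟶∃¬; all?) renaming (_≟_ to _≟ᶠ_)
open import Data.Fin.Permutation using (transpose)
import Data.Fin.Permutation.Components as Components
open import Data.List using (List; []; _∷_)
open import Data.List.Membership.Propositional using (_∈_)
open import Data.List.Relation.Unary.Any using (here; there)
open import Data.Product using (Σ; _×_; _,_; proj₁; proj₂)
open import Data.Sum using (_⊎_; inj₁; inj₂; [_,_])
open import Data.Empty using (⊥-elim)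
open import Function using (_∘_; Equivalence)
open import Relation.Nullary using (¬_; Dec; yes; no; does)
open import Relation.Nullary.Decidable using (dec-true; dec-false; _⊎-dec_)
open import Relation.Binary.PropositionalEquality using (_≡_; _≢_; refl; sym; trans; cong; cong₂; subst; module ≡-Reasoning)
open import Algebra.Properties.Semiring.Sum +-*-semiring
  using (sum; sum-cong-≗; ∑-comm; ∑-distrib-+; *-distribˡ-sum; *-distribʳ-sum; sum-permute)

open ≡-Reasoning

sumFin≡sum : ∀ {n} (f : Fin n → ℕ) → sumFin f ≡ sum f
sumFin≡sum {zero}  f = refl
sumFin≡sum {suc n} f = cong (f zero +_) (sumFin≡sum (λ i → f (suc i)))

sumFin-cong : ∀ {n} {f g : Fin n → ℕ} → (∀ i → f i ≡ g i) → sumFin f ≡ sumFin g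
sumFin-cong {f = f} {g} f≗g = trans (sumFin≡sum f) (trans (sum-cong-≗ f≗g) (sym (sumFin≡sum g)))

transpose-left : ∀ {n} (a b : Fin n) → Components.transpose a b a ≡ b
transpose-left a b rewrite dec-true (a ≟ᶠ a) refl = refl

transpose-right : ∀ {n} (a b : Fin n) → b ≢ a → Components.transpose a b b ≡ a
transpose-right a b b≢a rewrite dec-false (b ≟ᶠ a) b≢a | dec-true (b ≟ᶠ b) refl = refl

transpose-other : ∀ {n} {a b v : Fin n} → v ≢ a → v ≢ b → Components.transpose a b v ≡ v
transpose-other {a = a} {b} {v} v≢a v≢b rewrite dec-false (v ≟ᶠ a) v≢a | dec-false (v ≟ᶠ b) v≢b = refl

sum-exchange : ∀ {n} (f g : Fin n → ℕ) (a b : Fin n) → g a ≡ f b → g b ≡ f a →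
  (∀ v → v ≢ a → v ≢ b → g v ≡ f v) → sum g ≡ sum f
sum-exchange f g a b ga gb rest = trans (sum-cong-≗ g≗f∘τ) (sym (sum-permute f (transpose a b)))
  where
  g≗f∘τ : ∀ v → g v ≡ f (Components.transpose a b v)
  g≗f∘τ v = by-cases (v ≟ᶠ a) (v ≟ᶠ b)
    where
    by-cases : Dec (v ≡ a) → Dec (v ≡ b) → g v ≡ f (Components.transpose a b v)
    by-cases (yes refl) _          = trans ga (cong f (sym (transpose-left a b)))
    by-cases (no v≢a)   (yes refl) = trans gb (cong f (sym (transpose-right a v v≢a)))
    by-cases (no v≢a)   (no v≢b)   = trans (rest v v≢a v≢b) (cong f (sym (transpose-other v≢a v≢b)))

sum-mono : ∀ {n} {f g : Fin n → ℕ} → (∀ i → f i ≤ g i) → sum f ≤ sum g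
sum-mono {zero}  f≤g = z≤n
sum-mono {suc n} f≤g = +-mono-≤ (f≤g zero) (sum-mono (λ i → f≤g (suc i)))

+-tight : ∀ {a b c d} → a ≤ b → c ≤ d → a + c ≡ b + d → a ≡ b × c ≡ d
+-tight {a} {b} {c} {d} a≤b c≤d eq = ≤-antisym a≤b b≤a , ≤-antisym c≤d d≤c
  where
  b≤a : b ≤ a
  b≤a = +-cancelʳ-≤ c b a (≤-trans (+-monoʳ-≤ b c≤d) (≤-reflexive (sym eq)))
  d≤c : d ≤ c
  d≤c = +-cancelˡ-≤ a d c (≤-trans (+-monoˡ-≤ d a≤b) (≤-reflexive (sym eq)))

sum-tight : ∀ {n} {f g : Fin n → ℕ} → (∀ i → f i ≤ g i) → sum f ≡ sum g → ∀ i → f i ≡ g i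
sum-tight f≤g eq zero    = proj₁ (+-tight (f≤g zero) (sum-mono (λ i → f≤g (suc i))) eq)
sum-tight f≤g eq (suc i) =
  sum-tight (λ i → f≤g (suc i)) (proj₂ (+-tight (f≤g zero) (sum-mono (λ i → f≤g (suc i))) eq)) i

forcedᵇ : Bool → ℕ → ℕ → Bool
forcedᵇ true  r c = r <ᵇ c
forcedᵇ false r c = c <ᵇ r

-- Replacing the entry b by b′ does not raise val·(c − r), and strictly lowers
-- it at a forced cell; in ℕ the two sides are rearranged to avoid subtraction.
exchange-≤ : ∀ b b′ r c → b′ ≡ b ⊎ T (forcedᵇ b r c) →
  val b′ * c + val b * r ≤ val b * c + val b′ * r
exchange-≤ b     .b    r c (inj₁ refl) = ≤-refl
exchange-≤ true  true  r c (inj₂ _)    = ≤-refl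
exchange-≤ false false r c (inj₂ _)    = ≤-refl
exchange-≤ true  false r c (inj₂ r<c)
  rewrite +-identityʳ r | +-identityʳ c | +-identityʳ c = <⇒≤ (<ᵇ⇒< r c r<c)
exchange-≤ false true  r c (inj₂ c<r)
  rewrite +-identityʳ r | +-identityʳ c | +-identityʳ c = <⇒≤ (<ᵇ⇒< c r c<r)

exchange-≡ : ∀ b b′ r c → T (forcedᵇ b r c) →
  val b′ * c + val b * r ≡ val b * c + val b′ * r → b′ ≡ b
exchange-≡ true  true  r c _ _ = refl
exchange-≡ false false r c _ _ = refl
exchange-≡ true  false r c r<c eq
  rewrite +-identityʳ r | +-identityʳ c | +-identityʳ c = ⊥-elim (<⇒≢ (<ᵇ⇒< r c r<c) eq)
exchange-≡ false true  r c c<r eq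
  rewrite +-identityʳ r | +-identityʳ c | +-identityʳ c = ⊥-elim (<⇒≢ (<ᵇ⇒< c r c<r) eq)

column-weight : ∀ {n x} (N : Matrix n) → InLambda n x N → (hc : Fin n → ℕ) →
  sum (λ i → sum (λ j → val (N i j) * hc j)) ≡ x * sum hc
column-weight {x = x} N (_ , cols) hc = begin
  sum (λ i → sum (λ j → val (N i j) * hc j))  ≡⟨ ∑-comm (λ i j → val (N i j) * hc j) ⟩
  sum (λ j → sum (λ i → val (N i j) * hc j))  ≡⟨ sum-cong-≗ (λ j → sym (*-distribʳ-sum (hc j) (λ i → val (N i j)))) ⟩
  sum (λ j → sum (λ i → val (N i j)) * hc j)  ≡⟨ sum-cong-≗ (λ j → cong (_* hc j) (trans (sym (sumFin≡sum (λ i → val (N i j)))) (cols j))) ⟩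
  sum (λ j → x * hc j)                        ≡⟨ sym (*-distribˡ-sum x hc) ⟩
  x * sum hc                                  ∎

row-weight : ∀ {n x} (N : Matrix n) → InLambda n x N → (hr : Fin n → ℕ) →
  sum (λ i → sum (λ j → val (N i j) * hr i)) ≡ x * sum hr
row-weight {x = x} N (rows , _) hr = begin
  sum (λ i → sum (λ j → val (N i j) * hr i))  ≡⟨ sum-cong-≗ (λ i → sym (*-distribʳ-sum (hr i) (λ j → val (N i j)))) ⟩
  sum (λ i → sum (λ j → val (N i j)) * hr i)  ≡⟨ sum-cong-≗ (λ i → cong (_* hr i) (trans (sym (sumFin≡sum (λ j → val (N i j)))) (rows i))) ⟩
  sum (λ i → x * hr i)                        ≡⟨ sym (*-distribˡ-sum x hr) ⟩
  x * sum hr                                  ∎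

double-sum-+ : ∀ {n} (f g : Fin n → Fin n → ℕ) →
  sum (λ i → sum (λ j → f i j + g i j)) ≡ sum (λ i → sum (f i)) + sum (λ i → sum (g i))
double-sum-+ f g = trans (sum-cong-≗ (λ i → ∑-distrib-+ (f i) (g i))) (∑-distrib-+ (λ i → sum (f i)) (λ i → sum (g i)))

forced-cells-agree : ∀ {n x} (M M′ : Matrix n) → InLambda n x M → InLambda n x M′ →
  (hr hc : Fin n → ℕ) → (∀ i j → M′ i j ≡ M i j ⊎ T (forcedᵇ (M i j) (hr i) (hc j))) →
  ∀ i j → M′ i j ≡ M i j
forced-cells-agree {n} {x} M M′ inΛ inΛ′ hr hc status i j with status i j
... | inj₁ same   = same
... | inj₂ forced = exchange-≡ (M i j) (M′ i j) (hr i) (hc j) forced (tight i j)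
  where
  A B : Fin n → Fin n → ℕ
  A i j = val (M′ i j) * hc j + val (M i j) * hr i
  B i j = val (M i j) * hc j + val (M′ i j) * hr i

  A≤B : ∀ i j → A i j ≤ B i j
  A≤B i j = exchange-≤ (M i j) (M′ i j) (hr i) (hc j) (status i j)

  total : (N N′ : Matrix n) → InLambda n x N → InLambda n x N′ →
    sum (λ i → sum (λ j → val (N i j) * hc j + val (N′ i j) * hr i)) ≡ x * sum hc + x * sum hr
  total N N′ inΛN inΛN′ = trans (double-sum-+ (λ i j → val (N i j) * hc j) (λ i j → val (N′ i j) * hr i))
                                (cong₂ _+_ (column-weight N inΛN hc) (row-weight N′ inΛN′ hr))

  tight : ∀ i j → A i j ≡ B i j
  tight i = sum-tight (A≤B i)
    (sum-tight (λ i → sum-mono (A≤B i)) (trans (total M′ M inΛ′ inΛ) (sym (total M M′ inΛ inΛ′))) i)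

slack : ∀ {n} → Matrix n → (hr hc : Fin n → ℕ) → Cells n
slack M hr hc i j = not (forcedᵇ (M i j) (hr i) (hc j))

slack-defining : ∀ {n x} (M : Matrix n) (hr hc : Fin n → ℕ) → InLambda n x M →
  IsDefining n x M (slack M hr hc)
slack-defining M hr hc inΛ = inΛ , λ M′ inΛ′ agree →
  forced-cells-agree M M′ inΛ inΛ′ hr hc (λ i j → status (agree i j))
  where
  status : ∀ {b b′ r c} → (T (not (forcedᵇ b r c)) → b′ ≡ b) → b′ ≡ b ⊎ T (forcedᵇ b r c)
  status {b} {r = r} {c} agree with forcedᵇ b r c
  ... | true  = inj₂ tt
  ... | false = inj₁ (agree tt)

OneOf : ∀ {n} → Fin n → Fin n → Fin n → Set
OneOf u a b = u ≡ a ⊎ u ≡ b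

oneOf? : ∀ {n} (u a b : Fin n) → Dec (OneOf u a b)
oneOf? u a b = (u ≟ᶠ a) ⊎-dec (u ≟ᶠ b)

toggle-pair : ∀ {n} (f g : Fin n → Bool) (a b : Fin n) → f b ≡ not (f a) →
  (∀ {v} → OneOf v a b → g v ≡ not (f v)) → (∀ {v} → ¬ OneOf v a b → g v ≡ f v) →
  sumFin (λ v → val (g v)) ≡ sumFin (λ v → val (f v))
toggle-pair f g a b fb toggled kept = begin
  sumFin (val ∘ g)  ≡⟨ sumFin≡sum (val ∘ g) ⟩
  sum (val ∘ g)     ≡⟨ sum-exchange (val ∘ f) (val ∘ g) a b (cong val ga) (cong val gb)
                         (λ v v≢a v≢b → cong val (kept [ v≢a , v≢b ])) ⟩
  sum (val ∘ f)     ≡⟨ sym (sumFin≡sum (val ∘ f)) ⟩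
  sumFin (val ∘ f)  ∎
  where
  ga : g a ≡ f b
  ga = trans (toggled (inj₁ refl)) (sym fb)
  gb : g b ≡ f a
  gb = trans (toggled (inj₂ refl)) (trans (cong not fb) (not-involutive (f a)))

-- Rows i, i′ and columns j, j′ of M carry the alternating pattern [b ¬b; ¬b b].
-- Stated for arbitrary index sets so that it also applies to block patterns.
record Alternating {I J : Set} (M : I → J → Bool) (i : I) (j : J) (i′ : I) (j′ : J) : Set where
  constructor alternating
  field
    row-flip : M i j′ ≡ not (M i j)
    col-flip : M i′ j ≡ not (M i j)
    diagonal : M i′ j′ ≡ M i j

record Avoids {I J : Set} (S : I → J → Bool) (i : I) (j : J) (i′ : I) (j′ : J) : Set where
  constructor avoids
  field
    row-corner      : S i j′ ≡ false
    col-corner      : S i′ j ≡ false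
    opposite-corner : S i′ j′ ≡ false

module Interchange {n : ℕ} (M : Matrix n) (i j i′ j′ : Fin n) where

  M′ : Matrix n
  M′ u v = if does (oneOf? u i i′) ∧ does (oneOf? v j j′) then not (M u v) else M u v

  corner : ∀ {u v} → OneOf u i i′ → OneOf v j j′ → M′ u v ≡ not (M u v)
  corner {u} {v} ou ov rewrite dec-true (oneOf? u i i′) ou | dec-true (oneOf? v j j′) ov = refl

  off-row : ∀ {u v} → ¬ OneOf u i i′ → M′ u v ≡ M u v
  off-row {u} ¬ou rewrite dec-false (oneOf? u i i′) ¬ou = refl

  off-col : ∀ {u v} → ¬ OneOf v j j′ → M′ u v ≡ M u v
  off-col {u} {v} ¬ov rewrite dec-false (oneOf? v j j′) ¬ov | ∧-zeroʳ (does (oneOf? u i i′)) = refl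

  changed : ∀ {u v} → M′ u v ≢ M u v → OneOf u i i′ × OneOf v j j′
  changed {u} {v} differ with oneOf? u i i′ | oneOf? v j j′
  ... | yes ou | yes ov = ou , ov
  ... | no ¬ou | _      = ⊥-elim (differ (off-row ¬ou))
  ... | yes _  | no ¬ov = ⊥-elim (differ (off-col ¬ov))

  module _ (alt : Alternating M i j i′ j′) where
    open Alternating alt

    rows-alternate : ∀ {u} → OneOf u i i′ → M u j′ ≡ not (M u j)
    rows-alternate (inj₁ refl) = row-flip
    rows-alternate (inj₂ refl) = trans diagonal (trans (sym (not-involutive (M i j))) (cong not (sym col-flip)))

    cols-alternate : ∀ {v} → OneOf v j j′ → M i′ v ≡ not (M i v)
    cols-alternate (inj₁ refl) = col-flip
    cols-alternate (inj₂ refl) = trans diagonal (trans (sym (not-involutive (M i j))) (cong not (sym row-flip)))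

    preserves-Λ : ∀ {x} → InLambda n x M → InLambda n x M′
    preserves-Λ {x} (rows , cols) = rows′ , cols′
      where
      rows′ : ∀ u → sumFin (λ v → val (M′ u v)) ≡ x
      rows′ u with oneOf? u i i′
      ... | yes ou = trans (toggle-pair (M u) (M′ u) j j′ (rows-alternate ou) (corner ou) off-col) (rows u)
      ... | no ¬ou = trans (sumFin-cong (λ v → cong val (off-row {v = v} ¬ou))) (rows u)
      cols′ : ∀ v → sumFin (λ u → val (M′ u v)) ≡ x
      cols′ v with oneOf? v j j′
      ... | yes ov = trans (toggle-pair (λ u → M u v) (λ u → M′ u v) i i′ (cols-alternate ov)
                                        (λ ou → corner ou ov) off-row) (cols v)
      ... | no ¬ov = trans (sumFin-cong (λ u → cong val (off-col {u = u} ¬ov))) (cols v)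

missing-cell : ∀ {n} {S S′ : Cells n} → S′ ⊂C S → Σ (Fin n) λ i → Σ (Fin n) λ j → T (S i j) × ¬ T (S′ i j)
missing-cell {n} {S} {S′} (S′⊆S , S′≢S)
  with ¬∀⟶∃¬ n (λ i → ∀ j → S′ i j ≡ S i j) (λ i → all? (λ j → S′ i j ≟ᵇ S i j)) S′≢S
... | i , row≢ with ¬∀⟶∃¬ n (λ j → S′ i j ≡ S i j) (λ j → S′ i j ≟ᵇ S i j) row≢
... | j , cell≢ = i , j , only-in-S (S′⊆S i j) cell≢
  where
  only-in-S : ∀ {s s′} → (T s′ → T s) → s′ ≢ s → T s × ¬ T s′
  only-in-S {true}  {false} _   _  = tt , λ ()
  only-in-S {true}  {true}  _   ne = ⊥-elim (ne refl)
  only-in-S {false} {false} _   ne = ⊥-elim (ne refl)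
  only-in-S {false} {true}  sub _  = ⊥-elim (sub tt)

-- A defining set is critical when each of its cells lies on an alternating
-- rectangle avoiding the set elsewhere: the interchange of that rectangle is a
-- second matrix of Λₙˣ agreeing with M on any subset missing the cell.
critical-by-interchanges : ∀ {n x} (M : Matrix n) (S : Cells n) → IsDefining n x M S →
  (∀ i j → T (S i j) → Σ (Fin n) λ i′ → Σ (Fin n) λ j′ → Alternating M i j i′ j′ × Avoids S i j i′ j′) →
  IsCritical n x M S
critical-by-interchanges {n} {x} M S defining rectangle = defining , minimal
  where
  minimal : ∀ S′ → S′ ⊂C S → ¬ IsDefining n x M S′
  minimal S′ S′⊂S (_ , unique) with missing-cell S′⊂S
  ... | i , j , ij∈S , ij∉S′ with rectangle i j ij∈S
  ... | i′ , j′ , alt , avoids row-corner col-corner opposite-corner =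
    not-¬ refl (trans (sym (unique M′ (preserves-Λ alt (proj₁ defining)) agrees i j)) (corner (inj₁ refl) (inj₁ refl)))
    where
    open Interchange M i j i′ j′

    outside : ∀ {u v} → S u v ≡ false → ¬ T (S′ u v)
    outside {u} {v} notInS inS′ = subst T notInS (proj₁ S′⊂S u v inS′)

    agrees : ∀ u v → T (S′ u v) → M′ u v ≡ M u v
    agrees u v inS′ with M′ u v ≟ᵇ M u v
    ... | yes same = same
    ... | no differ with changed differ
    ... | inj₁ refl , inj₁ refl = ⊥-elim (ij∉S′ inS′)
    ... | inj₁ refl , inj₂ refl = ⊥-elim (outside row-corner inS′)
    ... | inj₂ refl , inj₁ refl = ⊥-elim (outside col-corner inS′)
    ... | inj₂ refl , inj₂ refl = ⊥-elim (outside opposite-corner inS′)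

-- Consecutive blocks of positions 0, 1, …, each block labelled by a class.
Blocks : Set → Set
Blocks C = List (ℕ × C)

width : ∀ {C} → Blocks C → ℕ
width []             = 0
width ((l , _) ∷ bs) = l + width bs

-- The class of position x (the default d past the end of the layout).
classAt : ∀ {C} → C → Blocks C → ℕ → C
classAt d []             x = d
classAt d ((l , c) ∷ bs) x = if x <ᵇ l then c else classAt d bs (x ∸ l)

weigh : ∀ {C} → (C → ℕ) → Blocks C → ℕ
weigh φ []             = 0
weigh φ ((l , c) ∷ bs) = l * φ c + weigh φ bs

<ᵇ-false : ∀ {m n} → n ≤ m → (m <ᵇ n) ≡ false
<ᵇ-false {m} {n} n≤m with m <ᵇ n in below
... | true  = ⊥-elim (≤⇒≯ n≤m (<ᵇ⇒< m n (subst T (sym below) tt)))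
... | false = refl

classAt-here : ∀ {C} (d : C) {l c} bs {x} → x < l → classAt d ((l , c) ∷ bs) x ≡ c
classAt-here d bs x<l rewrite Equivalence.to T-≡ (<⇒<ᵇ x<l) = refl

classAt-beyond : ∀ {C} (d : C) {l c} bs {x} → l ≤ x → classAt d ((l , c) ∷ bs) x ≡ classAt d bs (x ∸ l)
classAt-beyond d bs l≤x rewrite <ᵇ-false l≤x = refl

classAt-shift : ∀ {C} (d : C) {l c} bs x → classAt d ((l , c) ∷ bs) (l + x) ≡ classAt d bs x
classAt-shift d {l} bs x = trans (classAt-beyond d bs (m≤m+n l x)) (cong (classAt d bs) (m+n∸m≡n l x))

classAt-inhabited : ∀ {C} (d : C) bs {l c} → (l , c) ∈ bs → 0 < l →
  Σ ℕ λ x → x < width bs × classAt d bs x ≡ c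
classAt-inhabited d ((_ , _) ∷ bs) (here refl) (s≤s z≤n) = 0 , s≤s z≤n , refl
classAt-inhabited d ((l₀ , c₀) ∷ bs) (there mem) pos with classAt-inhabited d bs mem pos
... | x , x<w , at-x = l₀ + x , +-monoʳ-< l₀ x<w , trans (classAt-shift d {l₀} {c₀} bs x) at-x

classAt-occupied : ∀ {C} (d : C) bs x → x < width bs →
  Σ ℕ λ l → (l , classAt d bs x) ∈ bs × 0 < l
classAt-occupied d ((l , c) ∷ bs) x x<w with x <? l
... | yes x<l = l , here (cong (l ,_) (classAt-here d bs x<l)) , ≤-<-trans z≤n x<l
... | no x≮l with classAt-occupied d bs (x ∸ l) shifted
  where
  shifted : x ∸ l < width bs
  shifted = subst (x ∸ l <_) (m+n∸m≡n l (width bs)) (∸-monoˡ-< x<w (≮⇒≥ x≮l))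
... | l′ , mem , pos =
  l′ , there (subst (λ c′ → (l′ , c′) ∈ bs) (sym (classAt-beyond d bs (≮⇒≥ x≮l))) mem) , pos

sumℕ : ℕ → (ℕ → ℕ) → ℕ
sumℕ zero    g = 0
sumℕ (suc l) g = g 0 + sumℕ l (λ x → g (suc x))

sum-toℕ : ∀ {n} (g : ℕ → ℕ) → sum {n} (λ j → g (toℕ j)) ≡ sumℕ n g
sum-toℕ {zero}  g = refl
sum-toℕ {suc n} g = cong (g 0 +_) (sum-toℕ {n} (λ x → g (suc x)))

sumℕ-split : ∀ l₁ l₂ (g : ℕ → ℕ) → sumℕ (l₁ + l₂) g ≡ sumℕ l₁ g + sumℕ l₂ (λ x → g (l₁ + x))
sumℕ-split zero     l₂ g = refl
sumℕ-split (suc l₁) l₂ g = trans (cong (g 0 +_) (sumℕ-split l₁ l₂ (λ x → g (suc x)))) (sym (+-assoc (g 0) _ _))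

sumℕ-cong : ∀ l {g h : ℕ → ℕ} → (∀ x → x < l → g x ≡ h x) → sumℕ l g ≡ sumℕ l h
sumℕ-cong zero    g≗h = refl
sumℕ-cong (suc l) g≗h = cong₂ _+_ (g≗h 0 (s≤s z≤n)) (sumℕ-cong l (λ x x<l → g≗h (suc x) (s≤s x<l)))

sumℕ-const : ∀ l c → sumℕ l (λ _ → c) ≡ l * c
sumℕ-const zero    c = refl
sumℕ-const (suc l) c = cong (c +_) (sumℕ-const l c)

sumℕ-blocks : ∀ {C} (d : C) (φ : C → ℕ) bs → sumℕ (width bs) (λ x → φ (classAt d bs x)) ≡ weigh φ bs
sumℕ-blocks d φ []             = refl
sumℕ-blocks d φ ((l , c) ∷ bs) = begin
  sumℕ (l + width bs) (λ x → φ (classAt d ((l , c) ∷ bs) x))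
    ≡⟨ sumℕ-split l (width bs) _ ⟩
  sumℕ l (λ x → φ (classAt d ((l , c) ∷ bs) x)) + sumℕ (width bs) (λ x → φ (classAt d ((l , c) ∷ bs) (l + x)))
    ≡⟨ cong₂ _+_ (sumℕ-cong l (λ x x<l → cong φ (classAt-here d bs x<l)))
                 (sumℕ-cong (width bs) (λ x _ → cong φ (classAt-shift d {l} {c} bs x))) ⟩
  sumℕ l (λ _ → φ c) + sumℕ (width bs) (λ x → φ (classAt d bs x))
    ≡⟨ cong₂ _+_ (sumℕ-const l (φ c)) (sumℕ-blocks d φ bs) ⟩
  l * φ c + weigh φ bs ∎

sum-by-blocks : ∀ {C n} (d : C) bs (φ : C → ℕ) → width bs ≡ n →
  sum {n} (λ j → φ (classAt d bs (toℕ j))) ≡ weigh φ bs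
sum-by-blocks d bs φ refl = trans (sum-toℕ {width bs} (λ x → φ (classAt d bs x))) (sumℕ-blocks d φ bs)

positionOf : ∀ {C n} (d : C) bs → width bs ≡ n → ∀ {l c} → (l , c) ∈ bs → 0 < l →
  Σ (Fin n) λ j → classAt d bs (toℕ j) ≡ c
positionOf d bs refl mem pos with classAt-inhabited d bs mem pos
... | x , x<w , at-x = fromℕ< x<w , trans (cong (classAt d bs) (toℕ-fromℕ< x<w)) at-x

data RowClass : Set where
  top middle bottom : RowClass

data ColClass : Set where
  left₁ left₂ right₁ right₂ : ColClass

-- The block matrix [J 0; 0 J].
shape : RowClass → ColClass → Bool
shape top left₁  = true
shape top left₂  = true
shape top right₁ = false
shape top right₂ = false
shape _   left₁  = false
shape _   left₂  = false
shape _   right₁ = true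
shape _   right₂ = true

rowPotential : RowClass → ℕ
rowPotential top    = 3
rowPotential middle = 1
rowPotential bottom = 5

colPotential : ColClass → ℕ
colPotential left₁  = 0
colPotential left₂  = 4
colPotential right₁ = 6
colPotential right₂ = 2

-- The slack pattern: top×left₁, top×right₁, middle×left₂ and bottom×right₂.
shapeSlack : RowClass → ColClass → Bool
shapeSlack R C = not (forcedᵇ (shape R C) (rowPotential R) (colPotential C))

slack-size-arith : ∀ p a a′ r r′ → a + a′ ≡ p → r + r′ ≡ p →
  suc p * (a + r) + (1 * suc a′ + (p * suc r′ + 0)) ≡ suc p * suc p + (r + a * p)
slack-size-arith p a a′ r r′ ea er = begin
  suc p * (a + r) + (1 * suc a′ + (p * suc r′ + 0))  ≡⟨ expand p a a′ r r′ ⟩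
  p * (r + r′) + (a + a′) + (suc p + (r + a * p))    ≡⟨ cong₂ (λ u v → p * u + v + (suc p + (r + a * p))) er ea ⟩
  p * p + p + (suc p + (r + a * p))                  ≡⟨ collect p (r + a * p) ⟩
  suc p * suc p + (r + a * p)                        ∎
  where
  expand : ∀ p a a′ r r′ →
    suc p * (a + r) + (1 * suc a′ + (p * suc r′ + 0)) ≡ p * (r + r′) + (a + a′) + (suc p + (r + a * p))
  expand = solve-∀
  collect : ∀ p t → p * p + p + (suc p + t) ≡ suc p * suc p + t
  collect = solve-∀

-- For m = 1 + p and a, r ≤ p: the matrix [J 0; 0 J] of Λ_{2m}^m, laid out in
-- blocks, with potentials whose slack set is critical of size m² + r + a·p.
module Construction (p a r : ℕ) (a≤p : a ≤ p) (r≤p : r ≤ p) where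

  m n : ℕ
  m = suc p
  n = 2 * m

  rowBlocks : Blocks RowClass
  rowBlocks = (m , top) ∷ (1 , middle) ∷ (p , bottom) ∷ []

  colBlocks : Blocks ColClass
  colBlocks = (a , left₁) ∷ (suc (p ∸ a) , left₂) ∷ (r , right₁) ∷ (suc (p ∸ r) , right₂) ∷ []

  fill : ∀ {b} → b ≤ p → b + suc (p ∸ b) ≡ m
  fill b≤p = trans (+-suc _ _) (cong suc (m+[n∸m]≡n b≤p))

  colWidth : width colBlocks ≡ n
  colWidth = trans (sym (+-assoc a _ _))
    (cong₂ _+_ (fill a≤p) (trans (cong (r +_) (+-identityʳ _)) (trans (fill r≤p) (sym (+-identityʳ m)))))

  ρ : Fin n → RowClass
  ρ i = classAt top rowBlocks (toℕ i)

  κ : Fin n → ColClass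
  κ j = classAt left₁ colBlocks (toℕ j)

  M : Matrix n
  M i j = shape (ρ i) (κ j)

  S : Cells n
  S = slack M (rowPotential ∘ ρ) (colPotential ∘ κ)

  over-rows : (φ : RowClass → ℕ) → sum (λ i → φ (ρ i)) ≡ weigh φ rowBlocks
  over-rows φ = sum-by-blocks top rowBlocks φ refl

  over-cols : (φ : ColClass → ℕ) → sum (λ j → φ (κ j)) ≡ weigh φ colBlocks
  over-cols φ = sum-by-blocks left₁ colBlocks φ colWidth

  row-counts : ∀ R → weigh (λ C → val (shape R C)) colBlocks ≡ m
  row-counts top    = trans (left-ones a (suc (p ∸ a)) r (suc (p ∸ r))) (fill a≤p)
    where
    left-ones : ∀ w x y z → w * 1 + (x * 1 + (y * 0 + (z * 0 + 0))) ≡ w + x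
    left-ones = solve-∀
  row-counts middle = trans (right-ones a (suc (p ∸ a)) r (suc (p ∸ r))) (fill r≤p)
    where
    right-ones : ∀ w x y z → w * 0 + (x * 0 + (y * 1 + (z * 1 + 0))) ≡ y + z
    right-ones = solve-∀
  row-counts bottom = row-counts middle

  col-counts : ∀ C → weigh (λ R → val (shape R C)) rowBlocks ≡ m
  col-counts left₁  = top-only p
    where
    top-only : ∀ p → suc p * 1 + (1 * 0 + (p * 0 + 0)) ≡ suc p
    top-only = solve-∀
  col-counts left₂  = col-counts left₁
  col-counts right₁ = lower-only p
    where
    lower-only : ∀ p → suc p * 0 + (1 * 1 + (p * 1 + 0)) ≡ suc p
    lower-only = solve-∀
  col-counts right₂ = col-counts right₁

  M∈Λ : InLambda n m M
  M∈Λ = (λ i → trans (sumFin≡sum (λ j → val (M i j))) (trans (over-cols (λ C → val (shape (ρ i) C))) (row-counts (ρ i))))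
      , (λ j → trans (sumFin≡sum (λ i → val (M i j))) (trans (over-rows (λ R → val (shape R (κ j)))) (col-counts (κ j))))

  slackCount : RowClass → ℕ
  slackCount top    = a + r
  slackCount middle = suc (p ∸ a)
  slackCount bottom = suc (p ∸ r)

  slack-per-row : ∀ R → weigh (λ C → val (shapeSlack R C)) colBlocks ≡ slackCount R
  slack-per-row top    = pick₁₃ a (suc (p ∸ a)) r (suc (p ∸ r))
    where
    pick₁₃ : ∀ w x y z → w * 1 + (x * 0 + (y * 1 + (z * 0 + 0))) ≡ w + y
    pick₁₃ = solve-∀
  slack-per-row middle = pick₂ a (suc (p ∸ a)) r (suc (p ∸ r))
    where
    pick₂ : ∀ w x y z → w * 0 + (x * 1 + (y * 0 + (z * 0 + 0))) ≡ x
    pick₂ = solve-∀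
  slack-per-row bottom = pick₄ a (suc (p ∸ a)) r (suc (p ∸ r))
    where
    pick₄ : ∀ w x y z → w * 0 + (x * 0 + (y * 0 + (z * 1 + 0))) ≡ z
    pick₄ = solve-∀

  size-S : size S ≡ m * m + (r + a * p)
  size-S = begin
    sumFin (λ i → sumFin (λ j → val (S i j)))
      ≡⟨ sumFin-cong (λ i → sumFin≡sum (λ j → val (S i j))) ⟩
    sumFin (λ i → sum (λ j → val (shapeSlack (ρ i) (κ j))))
      ≡⟨ sumFin-cong (λ i → trans (over-cols (λ C → val (shapeSlack (ρ i) C))) (slack-per-row (ρ i))) ⟩
    sumFin (λ i → slackCount (ρ i))
      ≡⟨ trans (sumFin≡sum (slackCount ∘ ρ)) (over-rows slackCount) ⟩
    m * (a + r) + (1 * suc (p ∸ a) + (p * suc (p ∸ r) + 0))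
      ≡⟨ slack-size-arith p a (p ∸ a) r (p ∸ r) (m+[n∸m]≡n a≤p) (m+[n∸m]≡n r≤p) ⟩
    m * m + (r + a * p) ∎

  lift : ∀ {i j i′ j′ R C R′ C′} → ρ i ≡ R → κ j ≡ C → ρ i′ ≡ R′ → κ j′ ≡ C′ →
    Alternating shape R C R′ C′ × Avoids shapeSlack R C R′ C′ → Alternating M i j i′ j′ × Avoids S i j i′ j′
  lift refl refl refl refl (alternating f₁ f₂ f₃ , avoids g₁ g₂ g₃) = alternating f₁ f₂ f₃ , avoids g₁ g₂ g₃

  rowOf : ∀ {l R} → (l , R) ∈ rowBlocks → 0 < l → Σ (Fin n) λ i → ρ i ≡ R
  rowOf = positionOf top rowBlocks refl

  colOf : ∀ {l C} → (l , C) ∈ colBlocks → 0 < l → Σ (Fin n) λ j → κ j ≡ C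
  colOf = positionOf left₁ colBlocks colWidth

  -- A column of class right₁ exists only if r ≥ 1, and then there are bottom rows.
  bottom-nonempty : ∀ j → κ j ≡ right₁ → 0 < p
  bottom-nonempty j κj≡right₁ with classAt-occupied left₁ colBlocks (toℕ j) (subst (toℕ j <_) (sym colWidth) (toℕ<n j))
  ... | l , mem , pos = ≤-trans (subst (0 <_) (right₁-width (subst (λ C → (l , C) ∈ colBlocks) κj≡right₁ mem)) pos) r≤p
    where
    right₁-width : ∀ {l} → (l , right₁) ∈ colBlocks → l ≡ r
    right₁-width (here ())
    right₁-width (there (here ()))
    right₁-width (there (there (here refl))) = refl
    right₁-width (there (there (there (here ()))))
    right₁-width (there (there (there (there ()))))

  -- Every slack cell lies on an alternating rectangle avoiding the slack set elsewhere;
  -- the partner classes are read off from the 3×4 class pattern.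
  rectangles : ∀ i j → T (S i j) →
    Σ (Fin n) λ i′ → Σ (Fin n) λ j′ → Alternating M i j i′ j′ × Avoids S i j i′ j′
  rectangles i j = byClass (ρ i) (κ j) refl refl
    where
    through : ∀ {R C R′ C′} → ρ i ≡ R → κ j ≡ C → Σ (Fin n) (λ i′ → ρ i′ ≡ R′) → Σ (Fin n) (λ j′ → κ j′ ≡ C′) →
      Alternating shape R C R′ C′ × Avoids shapeSlack R C R′ C′ →
      Σ (Fin n) λ i′ → Σ (Fin n) λ j′ → Alternating M i j i′ j′ × Avoids S i j i′ j′
    through eR eC (i′ , eR′) (j′ , eC′) rect = i′ , j′ , lift eR eC eR′ eC′ rect

    byClass : ∀ R C → ρ i ≡ R → κ j ≡ C → T (shapeSlack R C) →
      Σ (Fin n) λ i′ → Σ (Fin n) λ j′ → Alternating M i j i′ j′ × Avoids S i j i′ j′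
    byClass top    left₁  eR eC _ =
      through eR eC (rowOf (there (here refl)) (s≤s z≤n)) (colOf (there (there (there (here refl)))) (s≤s z≤n))
        (alternating refl refl refl , avoids refl refl refl)
    byClass top    right₁ eR eC _ =
      through eR eC (rowOf (there (there (here refl))) (bottom-nonempty j eC)) (colOf (there (here refl)) (s≤s z≤n))
        (alternating refl refl refl , avoids refl refl refl)
    byClass middle left₂  eR eC _ =
      through eR eC (rowOf (here refl) (s≤s z≤n)) (colOf (there (there (there (here refl)))) (s≤s z≤n))
        (alternating refl refl refl , avoids refl refl refl)
    byClass bottom right₂ eR eC _ =
      through eR eC (rowOf (here refl) (s≤s z≤n)) (colOf (there (here refl)) (s≤s z≤n))
        (alternating refl refl refl , avoids refl refl refl)
    byClass top    left₂  _ _ ()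
    byClass top    right₂ _ _ ()
    byClass middle left₁  _ _ ()
    byClass middle right₁ _ _ ()
    byClass middle right₂ _ _ ()
    byClass bottom left₁  _ _ ()
    byClass bottom left₂  _ _ ()
    byClass bottom right₁ _ _ ()

  result : Σ (Matrix n) λ M → InLambda n m M ×
    Σ (Cells n) λ S → IsCritical n m M S × size S ≡ m * m + (r + a * p)
  result = M , M∈Λ , S ,
    critical-by-interchanges M S (slack-defining M (rowPotential ∘ ρ) (colPotential ∘ κ) M∈Λ) rectangles ,
    size-S

-- Every t ≤ p² is r + a·p with a, r ≤ p (division with remainder by p).
decompose : ∀ p t → t ≤ p * p → Σ ℕ λ a → Σ ℕ λ r → a ≤ p × r ≤ p × t ≡ r + a * p
decompose zero    zero  _  = 0 , 0 , z≤n , z≤n , refl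
decompose (suc q) t     t≤ = t / suc q , t % suc q , quotient≤ , <⇒≤ (m%n<n t (suc q)) , m≡m%n+[m/n]*n t (suc q)
  where
  quotient≤ : t / suc q ≤ suc q
  quotient≤ = ≤-trans (/-monoˡ-≤ (suc q) t≤) (≤-reflexive (m*n/n≡m (suc q) (suc q)))

lemma15 : (m : ℕ) → 1 ≤ m → (k : ℕ) →
    m * m ≤ k → k ≤ m * m + (m ∸ 1) * (m ∸ 1) →
    Σ (Matrix (2 * m)) λ M → InLambda (2 * m) m M ×
    Σ (Cells (2 * m)) λ S → IsCritical (2 * m) m M S × size S ≡ k
lemma15 (suc p) (s≤s z≤n) k m²≤k k≤ with decompose p (k ∸ suc p * suc p) excess≤
  where
  excess≤ : k ∸ suc p * suc p ≤ p * p
  excess≤ = ≤-trans (∸-monoˡ-≤ (suc p * suc p) k≤) (≤-reflexive (m+n∸m≡n (suc p * suc p) (p * p)))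
... | a , r , a≤p , r≤p , excess≡ with Construction.result p a r a≤p r≤p
... | M , M∈Λ , S , critical , size≡ =
  M , M∈Λ , S , critical , trans size≡ (trans (cong (suc p * suc p +_) (sym excess≡)) (m+[n∸m]≡n m²≤k))
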